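{- The category $\mathsf{ContFCov}$ of continuous finitary covers and approximable maps is dually equivalent to the category $\mathsf{ContLat_{Scott}}$ of continuous lattices and Scott continuous functions.
   Context: Work constructively; $\mathrm{Fin}(S)$ = finitely enumerable subsets. A finitary cover is $(S,\blacktriangleleft)$ with $\blacktriangleleft\subseteq S\times\mathrm{Fin}(S)$ such that $a\in A\Rightarrow a\blacktriangleleft A$; $a\blacktriangleleft A\Rightarrow a\blacktriangleleft A\cup B$; and $a\blacktriangleleft A\cup\{b\}$, $b\blacktriangleleft A$ imply $a\blacktriangleleft A$. For $r\subseteq S\times\mathrm{Fin}(S')$ and $s\subseteq S'\times\mathrm{Fin}(S'')$, the cut composition is $a\,(s\cdot r)\,C\iff\exists B\,(a\,r\,B\ \&\ \forall b\in B\,(b\,s\,C))$. A continuous finitary cover is $(S,\blacktriangleleft,\ll)$ with $(S,\blacktriangleleft)$ a finitary cover and $\ll\subseteq S\times\mathrm{Fin}(S)$ such that $\ll\cdot\ll=\ll$ and $\blacktriangleleft\cdot\ll=\ll=\ll\cdot\blacktriangleleft$. An approximable map $(S,\blacktriangleleft,\ll)\to(S',\blacktriangleleft',\ll')$ is $r\subseteq S\times\mathrm{Fin}(S')$ with $r\cdot\ll=r=\ll'\cdot r$. $\mathsf{ContFCov}$: identity $\ll$, composition cut composition. A continuous lattice is a continuous domain with finite joins. -}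

module Defs where

open import Level using (Level; _⊔_) renaming (suc to lsuc; zero to lzero)
open import Data.List using (List; []; _∷_; _++_; [_])
open import Data.List.Membership.Propositional using (_∈_)
open import Data.List.Membership.Propositional.Properties using (∈-++⁺ˡ; ∈-++⁺ʳ; ∈-++⁻)
open import Data.List.Relation.Unary.Any using (here; there)
open import Data.Product using (Σ; _×_; _,_; proj₁; proj₂)
open import Data.Sum using (inj₁; inj₂)
open import Function using (_∘′_)
open import Relation.Binary.PropositionalEquality using (_≡_; refl)

-- Minimal category-theoretic vocabulary.
-- Hom-sets carry an equality _≈_ (setoid-style).  The category laws are
-- not recorded: they play no role in the *statement* of an equivalence.

record Cat (o h e : Level) : Set (lsuc (o ⊔ h ⊔ e)) where
  infixr 9 _∘_
  field
    Obj : Set o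
    Hom : Obj → Obj → Set h
    _≈_ : ∀ {A B} → Hom A B → Hom A B → Set e
    id  : ∀ {A} → Hom A A
    _∘_ : ∀ {A B C} → Hom B C → Hom A B → Hom A C

op : ∀ {o h e} → Cat o h e → Cat o h e
op C = record
  { Obj = Obj ; Hom = λ A B → Hom B A ; _≈_ = _≈_ ; id = id
  ; _∘_ = λ g f → f ∘ g }
  where open Cat C

record Functor {o h e o' h' e'} (C : Cat o h e) (D : Cat o' h' e')
       : Set (o ⊔ h ⊔ e ⊔ o' ⊔ h' ⊔ e') where
  private
    module C = Cat C
    module D = Cat D
  field
    F₀ : C.Obj → D.Obj
    F₁ : ∀ {A B} → C.Hom A B → D.Hom (F₀ A) (F₀ B)
    F-resp : ∀ {A B} {f g : C.Hom A B} → f C.≈ g → F₁ f D.≈ F₁ g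
    F-id : ∀ {A} → F₁ (C.id {A}) D.≈ D.id
    F-∘ : ∀ {A B E} (f : C.Hom A B) (g : C.Hom B E) →
          F₁ (g C.∘ f) D.≈ (F₁ g D.∘ F₁ f)

record Equivalence {o h e o' h' e'} (C : Cat o h e) (D : Cat o' h' e')
       : Set (o ⊔ h ⊔ e ⊔ o' ⊔ h' ⊔ e') where
  private
    module C = Cat C
    module D = Cat D
  field
    F : Functor C D
    G : Functor D C
  open Functor F renaming (F₀ to F₀; F₁ to F₁)
  open Functor G renaming (F₀ to G₀; F₁ to G₁)
  field
    η     : ∀ A → C.Hom (G₀ (F₀ A)) A
    η⁻¹   : ∀ A → C.Hom A (G₀ (F₀ A))
    η-iso₁ : ∀ A → (η A C.∘ η⁻¹ A) C.≈ C.id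
    η-iso₂ : ∀ A → (η⁻¹ A C.∘ η A) C.≈ C.id
    η-nat : ∀ {A B} (f : C.Hom A B) → (η B C.∘ G₁ (F₁ f)) C.≈ (f C.∘ η A)
    ε     : ∀ X → D.Hom (F₀ (G₀ X)) X
    ε⁻¹   : ∀ X → D.Hom X (F₀ (G₀ X))
    ε-iso₁ : ∀ X → (ε X D.∘ ε⁻¹ X) D.≈ D.id
    ε-iso₂ : ∀ X → (ε⁻¹ X D.∘ ε X) D.≈ D.id
    ε-nat : ∀ {X Y} (g : D.Hom X Y) → (ε Y D.∘ F₁ (G₁ g)) D.≈ (g D.∘ ε X)

DualEquivalence : ∀ {o h e o' h' e'} → Cat o h e → Cat o' h' e' →
                  Set (o ⊔ h ⊔ e ⊔ o' ⊔ h' ⊔ e')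
DualEquivalence C D = Equivalence (op C) D

-- Finitely enumerable subsets Fin(S) are represented by lists; membership
-- is list membership, union is _++_, {b} is [ b ].  Relations into Fin(S)
-- are required to be extensional (invariant under same-members).

Rel : Set → Set → Set₁
Rel S T = S → List T → Set

_⊆_ : {T : Set} → List T → List T → Set
A ⊆ B = ∀ x → x ∈ A → x ∈ B

_≋_ : {T : Set} → List T → List T → Set
A ≋ B = A ⊆ B × B ⊆ A

Extensional : {S T : Set} → Rel S T → Set
Extensional r = ∀ a A B → A ≋ B → r a A → r a B

infixr 9 _·_
_·_ : {S T U : Set} → Rel T U → Rel S T → Rel S U
(s · r) a C = Σ (List _) λ B → r a B × (∀ b → b ∈ B → s b C)

infix 4 _≐_
_≐_ : {S T : Set} → Rel S T → Rel S T → Set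
r ≐ r' = ∀ a C → (r a C → r' a C) × (r' a C → r a C)

record IsFinitaryCover {S : Set} (_◀_ : Rel S S) : Set where
  field
    ◀-ext  : Extensional _◀_
    ◀-refl : ∀ {a A} → a ∈ A → a ◀ A
    ◀-mono : ∀ {a} A B → a ◀ A → a ◀ (A ++ B)
    ◀-cut  : ∀ {a} A b → a ◀ (A ++ [ b ]) → b ◀ A → a ◀ A

record ContFCovObj : Set₁ where
  field
    S   : Set
    _◀_ : Rel S S
    _≪_ : Rel S S
    isFinitaryCover : IsFinitaryCover _◀_
    ≪-ext  : Extensional _≪_
    ≪-idem : (_≪_ · _≪_) ≐ _≪_
    ◀≪     : (_◀_ · _≪_) ≐ _≪_
    ≪◀     : (_≪_ · _◀_) ≐ _≪_
  open IsFinitaryCover isFinitaryCover public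

record Approximable (X Y : ContFCovObj) : Set₁ where
  private
    module X = ContFCovObj X
    module Y = ContFCovObj Y
  field
    rel    : Rel X.S Y.S
    rel-ext : Extensional rel
    rel-≪ˡ : (rel · X._≪_) ≐ rel
    rel-≪ʳ : (Y._≪_ · rel) ≐ rel

module _ {A T : Set} where
  collect : (P : A → List T → Set) (Q : T → Set) (B : List A) →
            (∀ b → b ∈ B → Σ (List T) λ C → P b C × (∀ c → c ∈ C → Q c)) →
            Σ (List T) λ L → (∀ b → b ∈ B → Σ (List T) λ C → P b C × C ⊆ L)
                           × (∀ c → c ∈ L → Q c)
  collect P Q [] f = [] , (λ b ()) , (λ c ())
  collect P Q (x ∷ B) f with f x (here refl) | collect P Q B (λ b m → f b (there m))
  ... | C , p , q | L , g , h =
    C ++ L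
    , (λ { b (here refl) → C , p , (λ c m → ∈-++⁺ˡ m)
         ; b (there m) → let (C' , p' , s) = g b m
                          in C' , p' , (λ c m' → ∈-++⁺ʳ C (s c m')) })
    , λ c m → Data.Sum.[ q c , h c ]′ (∈-++⁻ C m)

≪-up : (X : ContFCovObj) → let open ContFCovObj X in
       ∀ {a C C'} → C ⊆ C' → a ≪ C → a ≪ C'
≪-up X {a} {C} {C'} s p =
  proj₁ (◀≪ a C') (C , p , λ b m → ◀-refl (s b m))
  where open ContFCovObj X

rel-up : {X Y : ContFCovObj} (r : Approximable X Y) →
         ∀ {a C C'} → C ⊆ C' → Approximable.rel r a C → Approximable.rel r a C'
rel-up {X} {Y} r {a} {C} {C'} s p =
  let (B , q , t) = proj₂ (rel-≪ʳ a C) p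
  in proj₁ (rel-≪ʳ a C') (B , q , λ b m → ≪-up Y s (t b m))
  where open Approximable r

idApprox : (X : ContFCovObj) → Approximable X X
idApprox X = record
  { rel = _≪_ ; rel-ext = ≪-ext ; rel-≪ˡ = ≪-idem ; rel-≪ʳ = ≪-idem }
  where open ContFCovObj X

compApprox : {X Y Z : ContFCovObj} → Approximable Y Z → Approximable X Y →
             Approximable X Z
compApprox {X} {Y} {Z} s r = record
  { rel = S.rel · R.rel
  ; rel-ext = λ a A B e → λ { (C , p , q) → C , p , λ b m → S.rel-ext b A B e (q b m) }
  ; rel-≪ˡ = λ a D →
      (λ { (B , p , q) →
           let (L , g , h) = collect R.rel (λ c → S.rel c D) B (λ b m → q b m)
           in L , proj₁ (R.rel-≪ˡ a L)
                    (B , p , λ b m → let (C , pc , sc) = g b m in rel-up r sc pc)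
                , h })
    , (λ { (C , p , q) →
           let (B , p' , q') = proj₂ (R.rel-≪ˡ a C) p
           in B , p' , λ b m → C , q' b m , q })
  ; rel-≪ʳ = λ a E →
      (λ { (D , (C , p , q) , t) →
           C , p , λ c m → proj₁ (S.rel-≪ʳ c E) (D , q c m , t) })
    , (λ { (C , p , q) →
           let (L , g , h) = collect (λ c D → S.rel c D) (λ d → Z._≪_ d E) C
                               (λ c m → proj₂ (S.rel-≪ʳ c E) (q c m))
           in L , (C , p , λ c m → let (D , pd , sd) = g c m in rel-up s sd pd) , h })
  }
  where
    module R = Approximable r
    module S = Approximable s
    module Z = ContFCovObj Z

ContFCov : Cat (lsuc lzero) (lsuc lzero) lzero
ContFCov = record
  { Obj = ContFCovObj
  ; Hom = Approximable
  ; _≈_ = λ r r' → Approximable.rel r ≐ Approximable.rel r'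
  ; id = λ {X} → idApprox X
  ; _∘_ = compApprox
  }

-- Continuous lattices (predicatively: carriers are large, Set₁; directed
-- families are indexed by small types, Set).

record Directed {D : Set₁} (_≤_ : D → D → Set) {I : Set} (α : I → D) : Set where
  field
    inhabitant : I
    semidirected : ∀ i j → Σ I λ k → α i ≤ α k × α j ≤ α k

-- A dcpo.  The partial order is given as a preorder _≤_; equality of
-- elements is taken to be  x ≤ y × y ≤ x  (so antisymmetry holds by fiat).
record Dcpo : Set₂ where
  infix 4 _≤_
  field
    Carrier : Set₁
    _≤_     : Carrier → Carrier → Set
    ≤-refl  : ∀ {x} → x ≤ x
    ≤-trans : ∀ {x y z} → x ≤ y → y ≤ z → x ≤ z
    ⋁       : ∀ {I : Set} (α : I → Carrier) → Directed _≤_ α → Carrier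
    ⋁-upper : ∀ {I : Set} (α : I → Carrier) (d : Directed _≤_ α) i → α i ≤ ⋁ α d
    ⋁-least : ∀ {I : Set} (α : I → Carrier) (d : Directed _≤_ α) u →
              (∀ i → α i ≤ u) → ⋁ α d ≤ u

  _≪_ : Carrier → Carrier → Set₁
  x ≪ y = ∀ {I : Set} (α : I → Carrier) (d : Directed _≤_ α) →
          y ≤ ⋁ α d → Σ I λ i → x ≤ α i

-- Continuity is witnessed predicatively by a basis (a set Basis with
-- β : Basis → Carrier) such that  ↡x = {b | β b ≪ x}  is a (small) set,
-- directed, with join x.  Smallness of ↡x is expressed by a Set-valued
-- relation _≺_ equivalent to  β b ≪ x.
record ContLat : Set₂ where
  field
    dcpo : Dcpo
  open Dcpo dcpo public
  field
    bot      : Carrier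
    bot-least : ∀ x → bot ≤ x
    _∨_      : Carrier → Carrier → Carrier
    ∨-upperˡ : ∀ x y → x ≤ x ∨ y
    ∨-upperʳ : ∀ x y → y ≤ x ∨ y
    ∨-least  : ∀ x y z → x ≤ z → y ≤ z → x ∨ y ≤ z
    Basis : Set
    β     : Basis → Carrier
    _≺_   : Basis → Carrier → Set
    ≺⇒≪  : ∀ b x → b ≺ x → β b ≪ x
    ≪⇒≺  : ∀ b x → β b ≪ x → b ≺ x
    approx-directed : ∀ x → Directed _≤_ {Σ Basis λ b → b ≺ x} (λ p → β (proj₁ p))
    approx-joinˡ : ∀ x → x ≤ ⋁ (λ p → β (proj₁ p)) (approx-directed x)
    approx-joinʳ : ∀ x → ⋁ (λ p → β (proj₁ p)) (approx-directed x) ≤ x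

record ScottMap (L M : ContLat) : Set₁ where
  private
    module L = ContLat L
    module M = ContLat M
  field
    fun  : L.Carrier → M.Carrier
    mono : ∀ {x y} → x L.≤ y → fun x M.≤ fun y
    pres-⋁ : ∀ {I : Set} (α : I → L.Carrier) (d : Directed L._≤_ α) u →
             (∀ i → fun (α i) M.≤ u) → fun (L.⋁ α d) M.≤ u

image-directed : {L M : ContLat} (f : ContLat.Carrier L → ContLat.Carrier M) →
  (∀ {x y} → ContLat._≤_ L x y → ContLat._≤_ M (f x) (f y)) →
  ∀ {I : Set} {α : I → ContLat.Carrier L} → Directed (ContLat._≤_ L) α →
  Directed (ContLat._≤_ M) (λ i → f (α i))
image-directed f m d = record
  { inhabitant = Directed.inhabitant d
  ; semidirected = λ i j → let (k , p , q) = Directed.semidirected d i j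
                           in k , m p , m q }

idScott : (L : ContLat) → ScottMap L L
idScott L = record
  { fun = λ x → x ; mono = λ p → p
  ; pres-⋁ = λ α d u h → ⋁-least α d u h }
  where open ContLat L

compScott : {L M N : ContLat} → ScottMap M N → ScottMap L M → ScottMap L N
compScott {L} {M} {N} g f = record
  { fun = λ x → G.fun (F.fun x)
  ; mono = λ p → G.mono (F.mono p)
  ; pres-⋁ = λ α d u h →
      let d' = image-directed {L} {M} F.fun F.mono d
      in N.≤-trans
           (G.mono (F.pres-⋁ α d (M.⋁ (λ i → F.fun (α i)) d')
                     (λ i → M.⋁-upper (λ i → F.fun (α i)) d' i)))
           (G.pres-⋁ (λ i → F.fun (α i)) d' u h)
  }
  where
    module F = ScottMap f
    module G = ScottMap g
    module M = ContLat M
    module N = ContLat N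

ContLatScott : Cat (lsuc (lsuc lzero)) (lsuc lzero) (lsuc lzero)
ContLatScott = record
  { Obj = ContLat
  ; Hom = ScottMap
  ; _≈_ = λ {L} {M} f g → ∀ x →
            ContLat._≤_ M (ScottMap.fun f x) (ScottMap.fun g x)
          × ContLat._≤_ M (ScottMap.fun g x) (ScottMap.fun f x)
  ; id = λ {L} → idScott L
  ; _∘_ = compScott
  }

module Submission where

-- A continuous finitary cover X yields the lattice of its points: the ≪-rounded
-- subsets U of S (a ∈ U iff a ≪ A for some finite A ⊆ U), ordered by inclusion.
-- Joins are roundings of unions, and the principal points {a ∣ a ≪ A} form a
-- basis: {a ∣ a ≪ A} is way below U iff it lies below {a ∣ a ≪ C} for some
-- finite C ⊆ U. Conversely a continuous lattice L yields the cover on its basis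
-- with a ◀ A iff β a ≤ ⋁A and a ≪ A iff a ≺ ⋁A, where b ≺ x says that β b is way
-- below x. Approximable maps act on points by preimage, and a Scott map g gives
-- the relation b ≺ g(⋁A).
-- The counit sends a point to the join of the basis elements in it, with inverse
-- x ↦ ↡x; the unit sends a to the finite joins of principal points containing it.
-- Every law reduces to interpolation (b ≺ x gives b ≺ β d ≺ x for some d) and to
-- Scott continuity in the form: b ≺ g y already holds for y replaced by a finite
-- join of basis elements way below y.

open import Defs
open import Data.List using (List; []; _∷_; _++_; [_])
open import Data.List.Membership.Propositional using (_∈_)
open import Data.List.Membership.Propositional.Properties using (∈-++⁺ˡ; ∈-++⁺ʳ; ∈-++⁻)
open import Data.List.Relation.Unary.Any using (here; there)
open import Data.Product using (Σ; _×_; _,_; proj₁; proj₂)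
open import Data.Sum using (_⊎_; inj₁; inj₂; [_,_]′)
open import Data.Unit using (⊤; tt)
open import Data.Empty using (⊥)
open import Function using (_∘_)
open import Relation.Binary.PropositionalEquality using (refl)

open Functor using (F₀; F₁)

Every : {T : Set} → (T → Set) → List T → Set
Every P A = ∀ b → b ∈ A → P b

every-++⁺ : {T : Set} {P : T → Set} (A B : List T) → Every P A → Every P B → Every P (A ++ B)
every-++⁺ A B p q b m = [ p b , q b ]′ (∈-++⁻ A m)

every-[]⁺ : {T : Set} {P : T → Set} {x : T} → P x → Every P [ x ]
every-[]⁺ p b (here refl) = p

module ContLatProperties (L : ContLat) where
  open ContLat L

  ⋁β : List Basis → Carrier
  ⋁β []      = bot
  ⋁β (b ∷ A) = β b ∨ ⋁β A

  -- The lemmas of this module are opaque: the laws of the equivalence compare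
  -- lattices field by field, which would otherwise unfold every proof using them.
  opaque
    ≪⇒≤ : ∀ {x y} → x ≪ y → x ≤ y
    ≪⇒≤ {y = y} x≪y = proj₂ (x≪y (λ _ → y) constant (⋁-upper (λ _ → y) constant tt))
      where
      constant : Directed _≤_ {⊤} (λ _ → y)
      constant = record { inhabitant = tt ; semidirected = λ _ _ → tt , ≤-refl , ≤-refl }

    ≪-≤-trans : ∀ {x y z} → x ≪ y → y ≤ z → x ≪ z
    ≪-≤-trans x≪y y≤z α d z≤⋁ = x≪y α d (≤-trans y≤z z≤⋁)

    ≤-≪-trans : ∀ {x y z} → x ≤ y → y ≪ z → x ≪ z
    ≤-≪-trans x≤y y≪z α d z≤⋁ =
      let (i , y≤αi) = y≪z α d z≤⋁ in i , ≤-trans x≤y y≤αi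

    bot-≪ : ∀ {z} → bot ≪ z
    bot-≪ α d _ = Directed.inhabitant d , bot-least _

    ∨-≪ : ∀ {x y z} → x ≪ z → y ≪ z → (x ∨ y) ≪ z
    ∨-≪ x≪z y≪z α d z≤⋁ with x≪z α d z≤⋁ | y≪z α d z≤⋁
    ... | i , x≤αi | j , y≤αj =
      let (k , αi≤αk , αj≤αk) = Directed.semidirected d i j
      in k , ∨-least _ _ _ (≤-trans x≤αi αi≤αk) (≤-trans y≤αj αj≤αk)

    ≺-≤-trans : ∀ {b x y} → b ≺ x → x ≤ y → b ≺ y
    ≺-≤-trans {b} {x} {y} b≺x x≤y = ≪⇒≺ b y (≪-≤-trans (≺⇒≪ b x b≺x) x≤y)

    ≤-≺-trans : ∀ {b c x} → β b ≤ β c → c ≺ x → b ≺ x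
    ≤-≺-trans {b} {c} {x} b≤c c≺x = ≪⇒≺ b x (≤-≪-trans b≤c (≺⇒≪ c x c≺x))

    ≺⇒≤ : ∀ {b x} → b ≺ x → β b ≤ x
    ≺⇒≤ {b} {x} b≺x = ≪⇒≤ (≺⇒≪ b x b≺x)

    ⋁β-upper : ∀ {b} A → b ∈ A → β b ≤ ⋁β A
    ⋁β-upper (b ∷ A) (here refl) = ∨-upperˡ (β b) (⋁β A)
    ⋁β-upper (c ∷ A) (there b∈A) = ≤-trans (⋁β-upper A b∈A) (∨-upperʳ (β c) (⋁β A))

    ⋁β-least : ∀ A {y} → Every (λ b → β b ≤ y) A → ⋁β A ≤ y
    ⋁β-least []      _ = bot-least _
    ⋁β-least (b ∷ A) h = ∨-least _ _ _ (h b (here refl)) (⋁β-least A (λ c m → h c (there m)))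

    ⋁β-mono : ∀ A B → A ⊆ B → ⋁β A ≤ ⋁β B
    ⋁β-mono A B A⊆B = ⋁β-least A (λ b m → ⋁β-upper B (A⊆B b m))

    ⋁β-least-≺ : ∀ A {x} → Every (_≺ x) A → ⋁β A ≤ x
    ⋁β-least-≺ A h = ⋁β-least A (λ b m → ≺⇒≤ (h b m))

    ⋁β-≪ : ∀ A {x} → Every (_≺ x) A → ⋁β A ≪ x
    ⋁β-≪ []      _ = bot-≪
    ⋁β-≪ (b ∷ A) {x} h = ∨-≪ (≺⇒≪ b x (h b (here refl))) (⋁β-≪ A (λ c m → h c (there m)))

  FinSub : (Basis → Set) → Set
  FinSub P = Σ (List Basis) (Every P)

  finJoin : (P : Basis → Set) → FinSub P → Carrier
  finJoin P (A , _) = ⋁β A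

  finJoin-directed : (P : Basis → Set) → Directed _≤_ (finJoin P)
  finJoin-directed P = record
    { inhabitant = [] , (λ _ ())
    ; semidirected = λ (A , p) (B , q) →
        (A ++ B , every-++⁺ A B p q)
        , ⋁β-mono A (A ++ B) (λ _ → ∈-++⁺ˡ) , ⋁β-mono B (A ++ B) (λ _ → ∈-++⁺ʳ A)
    }

  supβ : (Basis → Set) → Carrier
  supβ P = ⋁ (finJoin P) (finJoin-directed P)

  private
    module TwoStepApprox (x : Carrier) where
      Index : Set
      Index = Σ (Σ Basis (_≺ x)) λ (d , _) → Σ Basis (_≺ β d)

      family : Index → Carrier
      family (_ , (c , _)) = β c

      directed : Directed _≤_ family
      directed = record
        { inhabitant = let d = Directed.inhabitant (approx-directed x)
                       in d , Directed.inhabitant (approx-directed (β (proj₁ d)))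
        ; semidirected = λ (d , (c , c≺d)) (d′ , (c′ , c′≺d′)) →
            let (d″ , d≤d″ , d′≤d″) = Directed.semidirected (approx-directed x) d d′
                (c″ , c≤c″ , c′≤c″) = Directed.semidirected (approx-directed (β (proj₁ d″)))
                                        (c , ≺-≤-trans c≺d d≤d″) (c′ , ≺-≤-trans c′≺d′ d′≤d″)
            in (d″ , c″) , c≤c″ , c′≤c″
        }

      ≤-⋁ : x ≤ ⋁ family directed
      ≤-⋁ = ≤-trans (approx-joinˡ x) (⋁-least _ (approx-directed x) _ λ d →
              ≤-trans (approx-joinˡ (β (proj₁ d)))
                (⋁-least _ (approx-directed (β (proj₁ d))) _ λ c → ⋁-upper family directed (d , c)))

  opaque
    supβ-upper : ∀ (P : Basis → Set) A → Every P A → ⋁β A ≤ supβ P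
    supβ-upper P A p = ⋁-upper (finJoin P) (finJoin-directed P) (A , p)

    supβ-least : ∀ (P : Basis → Set) {y} → (∀ A → Every P A → ⋁β A ≤ y) → supβ P ≤ y
    supβ-least P h = ⋁-least (finJoin P) (finJoin-directed P) _ (λ (A , p) → h A p)

    supβ-mono : ∀ {P Q : Basis → Set} → (∀ b → P b → Q b) → supβ P ≤ supβ Q
    supβ-mono {P} {Q} P⊆Q = supβ-least P (λ A p → supβ-upper Q A (λ b m → P⊆Q b (p b m)))

    ≤-supβ-≺ : ∀ x → x ≤ supβ (_≺ x)
    ≤-supβ-≺ x = ≤-trans (approx-joinˡ x)
      (⋁-least _ (approx-directed x) _ (λ (b , b≺x) →
         ≤-trans (⋁β-upper [ b ] (here refl)) (supβ-upper (_≺ x) [ b ] (every-[]⁺ b≺x))))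

    supβ-≺-≤ : ∀ x → supβ (_≺ x) ≤ x
    supβ-≺-≤ x = supβ-least (_≺ x) (λ A → ⋁β-least-≺ A)

    interpolate : ∀ {b x} → b ≺ x → Σ Basis λ d → b ≺ β d × d ≺ x
    interpolate {b} {x} b≺x =
      let (((d , d≺x) , (c , c≺d)) , b≤c) = ≺⇒≪ b x b≺x family directed ≤-⋁
      in d , ≤-≺-trans b≤c c≺d , d≺x
      where open TwoStepApprox x

    interpolate-⋁β : ∀ {b x} → b ≺ x → Σ (List Basis) λ B → b ≺ ⋁β B × Every (_≺ x) B
    interpolate-⋁β b≺x =
      let (d , b≺d , d≺x) = interpolate b≺x
      in [ d ] , ≺-≤-trans b≺d (⋁β-upper [ d ] (here refl)) , every-[]⁺ d≺x

    ≺-supβ-finite : ∀ {b} (P : Basis → Set) → b ≺ supβ P → Σ (List Basis) λ A → Every P A × b ≺ ⋁β A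
    ≺-supβ-finite P b≺P =
      let (d , b≺d , d≺P) = interpolate b≺P
          ((A , A⊆P) , d≤A) = ≺⇒≪ d _ d≺P (finJoin P) (finJoin-directed P) ≤-refl
      in A , A⊆P , ≺-≤-trans b≺d d≤A

module _ {L M : ContLat} (g : ScottMap L M) where
  private
    module L = ContLat L
    module M = ContLat M
    module PL = ContLatProperties L
    module PM = ContLatProperties M
  open ScottMap g

  ≺-fun-finite : ∀ {b y} → b M.≺ fun y →
                 Σ (List L.Basis) λ A → Every (L._≺ y) A × b M.≺ fun (PL.⋁β A)
  ≺-fun-finite {b} {y} b≺gy =
    let (d , b≺d , d≺gy) = PM.interpolate b≺gy
        ((A , A≺y) , d≤gA) =
          M.≺⇒≪ d _ (PM.≺-≤-trans d≺gy gy≤⋁) (fun ∘ finJoin ≺y) image-dir M.≤-refl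
    in A , A≺y , PM.≺-≤-trans b≺d d≤gA
    where
    open PL using (finJoin; finJoin-directed)
    ≺y : L.Basis → Set
    ≺y = L._≺ y
    image-dir : Directed M._≤_ (fun ∘ finJoin ≺y)
    image-dir = image-directed {L} {M} fun mono (finJoin-directed ≺y)
    gy≤⋁ : fun y M.≤ M.⋁ (fun ∘ finJoin ≺y) image-dir
    gy≤⋁ = M.≤-trans (mono (PL.≤-supβ-≺ y))
             (pres-⋁ _ (finJoin-directed ≺y) _ (M.⋁-upper _ image-dir))

module Points (X : ContFCovObj) where
  open ContFCovObj X

  record Point : Set₁ where
    field
      U        : S → Set
      rounded⇒ : ∀ {a} → U a → Σ (List S) λ A → a ≪ A × Every U A
      rounded⇐ : ∀ {a} A → a ≪ A → Every U A → U a
  open Point public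

  infix 4 _⊑_
  _⊑_ : Point → Point → Set
  P ⊑ Q = ∀ a → U P a → U Q a

  preimage : {Y : ContFCovObj} → Approximable X Y → (ContFCovObj.S Y → Set) → Point
  preimage r P = record
    { U = λ a → Σ (List _) λ C → rel a C × Every P C
    ; rounded⇒ = λ {a} (C , aC , C⊆P) →
        let (A , a≪A , AC) = proj₂ (rel-≪ˡ a C) aC
        in A , a≪A , λ b m → C , AC b m , C⊆P
    ; rounded⇐ = λ {a} A a≪A A⊆preimage →
        let (C , rC , C⊆P) = collect rel P A A⊆preimage
            ArC b m = let (_ , bD , D⊆C) = rC b m in rel-up r D⊆C bD
        in C , proj₁ (rel-≪ˡ a C) (A , a≪A , ArC) , C⊆P
    }
    where open Approximable r

  round : (S → Set) → Point
  round = preimage (idApprox X)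

  round-mono : ∀ {P Q : S → Set} → (∀ a → P a → Q a) → round P ⊑ round Q
  round-mono P⊆Q a (A , a≪A , A⊆P) = A , a≪A , λ b m → P⊆Q b (A⊆P b m)

  round-least : ∀ (P : S → Set) (Q : Point) → (∀ a → P a → U Q a) → round P ⊑ Q
  round-least P Q P⊆Q a (A , a≪A , A⊆P) = rounded⇐ Q A a≪A (λ b m → P⊆Q b (A⊆P b m))

  ⊑-round : ∀ (Q : Point) (P : S → Set) → (∀ a → U Q a → P a) → Q ⊑ round P
  ⊑-round Q P Q⊆P a u = let (A , a≪A , A⊆Q) = rounded⇒ Q u in A , a≪A , λ b m → Q⊆P b (A⊆Q b m)

  principal : List S → Point
  principal A = round (_∈ A)

  principal-intro : ∀ {a A} → a ≪ A → U (principal A) a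
  principal-intro a≪A = _ , a≪A , λ _ m → m

  principal-elim : ∀ {a A} → U (principal A) a → a ≪ A
  principal-elim (_ , a≪B , B⊆A) = ≪-up X B⊆A a≪B

  principal-least : ∀ {A} (Q : Point) → Every (U Q) A → principal A ⊑ Q
  principal-least Q A⊆Q = round-least _ Q A⊆Q

  principal-mono : ∀ {A B} → A ⊆ B → principal A ⊑ principal B
  principal-mono = round-mono

  module _ {I : Set} (α : I → Point) where
    ⋁ₚ : Point
    ⋁ₚ = round (λ a → Σ I λ i → U (α i) a)

    ⋁ₚ-upper : ∀ i → α i ⊑ ⋁ₚ
    ⋁ₚ-upper i = ⊑-round (α i) _ (λ _ u → i , u)

    ⋁ₚ-least : ∀ Q → (∀ i → α i ⊑ Q) → ⋁ₚ ⊑ Q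
    ⋁ₚ-least Q αi⊑Q = round-least _ Q (λ a (i , u) → αi⊑Q i a u)

    module _ (dir : Directed _⊑_ α) where
      every-in-one : ∀ A → Every (λ a → Σ I λ i → U (α i) a) A → Σ I λ k → Every (U (α k)) A
      every-in-one []      _ = Directed.inhabitant dir , λ _ ()
      every-in-one (a ∷ A) h =
        let (i , u)  = h a (here refl)
            (j , v)  = every-in-one A (λ b m → h b (there m))
            (k , i⊑k , j⊑k) = Directed.semidirected dir i j
        in k , λ { b (here refl) → i⊑k b u ; b (there m) → j⊑k b (v b m) }

      ⋁ₚ-elim : ∀ {a} → U ⋁ₚ a → Σ I λ i → U (α i) a
      ⋁ₚ-elim (A , a≪A , A⊆) = let (k , A⊆αk) = every-in-one A A⊆ in k , rounded⇐ (α k) A a≪A A⊆αk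

      every-⋁ₚ-elim : ∀ A → Every (U ⋁ₚ) A → Σ I λ k → Every (U (α k)) A
      every-⋁ₚ-elim A A⊆⋁ = every-in-one A (λ b m → ⋁ₚ-elim (A⊆⋁ b m))

  dcpo : Dcpo
  dcpo = record
    { Carrier = Point ; _≤_ = _⊑_
    ; ≤-refl = λ _ u → u ; ≤-trans = λ P⊑Q Q⊑R a u → Q⊑R a (P⊑Q a u)
    ; ⋁ = λ α _ → ⋁ₚ α ; ⋁-upper = λ α _ → ⋁ₚ-upper α ; ⋁-least = λ α _ → ⋁ₚ-least α }

  infix 4 _≺ₚ_
  _≺ₚ_ : List S → Point → Set
  A ≺ₚ P = Σ (List S) λ C → Every (U P) C × principal A ⊑ principal C

  ≺ₚ⇒⊑ : ∀ {A P} → A ≺ₚ P → principal A ⊑ P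
  ≺ₚ⇒⊑ {P = P} (C , C⊆P , A⊑C) a u = principal-least P C⊆P a (A⊑C a u)

  ≺ₚ⇒≪ : ∀ A P → A ≺ₚ P → Dcpo._≪_ dcpo (principal A) P
  ≺ₚ⇒≪ A P (C , C⊆P , A⊑C) α dir P⊑⋁ =
    let (k , C⊆αk) = every-⋁ₚ-elim α dir C (λ c m → P⊑⋁ c (C⊆P c m))
    in k , λ a u → principal-least (α k) C⊆αk a (A⊑C a u)

  ≪⇒≺ₚ : ∀ A P → Dcpo._≪_ dcpo (principal A) P → A ≺ₚ P
  ≪⇒≺ₚ A P A≪P =
    let ((C , C⊆P) , A⊑C) = A≪P finPrincipal finPrincipal-directed P⊑⋁
    in C , C⊆P , A⊑C
    where
    finPrincipal : Σ (List S) (Every (U P)) → Point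
    finPrincipal (C , _) = principal C

    finPrincipal-directed : Directed _⊑_ finPrincipal
    finPrincipal-directed = record
      { inhabitant = [] , λ _ ()
      ; semidirected = λ (C , C⊆P) (D , D⊆P) →
          (C ++ D , every-++⁺ C D C⊆P D⊆P)
          , principal-mono (λ _ → ∈-++⁺ˡ) , principal-mono (λ _ → ∈-++⁺ʳ C)
      }

    P⊑⋁ : P ⊑ ⋁ₚ finPrincipal
    P⊑⋁ a u = let (C , a≪C , C⊆P) = rounded⇒ P u
              in ⋁ₚ-upper finPrincipal (C , C⊆P) a (principal-intro a≪C)

  approx-directed : ∀ P → Directed _⊑_ {Σ (List S) (_≺ₚ P)} (principal ∘ proj₁)
  approx-directed P = record
    { inhabitant = [] , [] , (λ _ ()) , (λ _ u → u)
    ; semidirected = λ (A , C , C⊆P , A⊑C) (B , D , D⊆P , B⊑D) →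
        (C ++ D , C ++ D , every-++⁺ C D C⊆P D⊆P , λ _ u → u)
        , (λ a u → principal-mono (λ _ → ∈-++⁺ˡ) a (A⊑C a u))
        , (λ a u → principal-mono (λ _ → ∈-++⁺ʳ C) a (B⊑D a u))
    }

  lattice : ContLat
  ContLat.dcpo lattice = dcpo
  ContLat.bot lattice = round (λ _ → ⊥)
  ContLat.bot-least lattice P = round-least _ P (λ _ ())
  ContLat._∨_ lattice P Q = round (λ a → U P a ⊎ U Q a)
  ContLat.∨-upperˡ lattice P Q = ⊑-round P _ (λ _ → inj₁)
  ContLat.∨-upperʳ lattice P Q = ⊑-round Q _ (λ _ → inj₂)
  ContLat.∨-least lattice P Q R P⊑R Q⊑R = round-least _ R (λ a → [ P⊑R a , Q⊑R a ]′)
  ContLat.Basis lattice = List S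
  ContLat.β lattice = principal
  ContLat._≺_ lattice = _≺ₚ_
  ContLat.≺⇒≪ lattice = ≺ₚ⇒≪
  ContLat.≪⇒≺ lattice = ≪⇒≺ₚ
  ContLat.approx-directed lattice = approx-directed
  ContLat.approx-joinˡ lattice P a u =
    let (C , a≪C , C⊆P) = rounded⇒ P u
    in ⋁ₚ-upper (principal ∘ proj₁) (C , C , C⊆P , λ _ v → v) a (principal-intro a≪C)
  ContLat.approx-joinʳ lattice P = ⋁ₚ-least (principal ∘ proj₁) P (λ (A , A≺P) → ≺ₚ⇒⊑ {A} {P} A≺P)

basisCover : ContLat → ContFCovObj
basisCover L = cover
  where
  open ContLat L
  open ContLatProperties L

  cover : ContFCovObj
  ContFCovObj.S cover = Basis
  ContFCovObj._◀_ cover a A = β a ≤ ⋁β A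
  ContFCovObj._≪_ cover a A = a ≺ ⋁β A
  ContFCovObj.isFinitaryCover cover = record
    { ◀-ext  = λ a A B (A⊆B , _) a≤A → ≤-trans a≤A (⋁β-mono A B A⊆B)
    ; ◀-refl = λ {_} {A} → ⋁β-upper A
    ; ◀-mono = λ A B a≤A → ≤-trans a≤A (⋁β-mono A (A ++ B) (λ _ → ∈-++⁺ˡ))
    ; ◀-cut  = λ A b a≤Ab b≤A → ≤-trans a≤Ab (⋁β-least (A ++ [ b ]) λ c m →
                 [ ⋁β-upper A , (λ { (here refl) → b≤A }) ]′ (∈-++⁻ A m))
    }
  ContFCovObj.≪-ext cover a A B (A⊆B , _) a≺A = ≺-≤-trans a≺A (⋁β-mono A B A⊆B)
  ContFCovObj.≪-idem cover a C =
      (λ (B , a≺B , B≺C) → ≺-≤-trans a≺B (⋁β-least-≺ B B≺C))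
    , interpolate-⋁β
  ContFCovObj.◀≪ cover a C =
      (λ (B , a≺B , B◀C) → ≺-≤-trans a≺B (⋁β-least B B◀C))
    , (λ a≺C → C , a≺C , λ _ → ⋁β-upper C)
  ContFCovObj.≪◀ cover a C =
      (λ (B , a◀B , B≪C) → ≪⇒≺ a (⋁β C) (≤-≪-trans a◀B (⋁β-≪ B B≪C)))
    , (λ a≺C → [ a ] , ⋁β-upper [ a ] (here refl) , every-[]⁺ a≺C)

module _ {X Y : ContFCovObj} where
  private
    module X = Points X
    module Y = Points Y

  pull : Approximable Y X → ScottMap (Points.lattice X) (Points.lattice Y)
  pull r = record
    { fun = λ P → Y.preimage r (X.U P)
    ; mono = λ P⊑Q b (C , bC , C⊆P) → C , bC , λ c m → P⊑Q c (C⊆P c m)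
    ; pres-⋁ = λ α dir Q αi↦Q b (C , bC , C⊆⋁) →
        let (k , C⊆αk) = X.every-⋁ₚ-elim α dir C C⊆⋁ in αi↦Q k b (C , bC , C⊆αk)
    }

scottToApprox : {L M : ContLat} → ScottMap L M → Approximable (basisCover M) (basisCover L)
scottToApprox {L} {M} g = record
  { rel = λ b A → b M.≺ fun (PL.⋁β A)
  ; rel-ext = λ b A B (A⊆B , _) b≺gA → PM.≺-≤-trans b≺gA (mono (PL.⋁β-mono A B A⊆B))
  ; rel-≪ˡ = λ b A → (λ (B , b≺B , B≺gA) → PM.≺-≤-trans b≺B (PM.⋁β-least-≺ B B≺gA))
                   , PM.interpolate-⋁β
  ; rel-≪ʳ = λ b A → (λ (B , b≺gB , B≺A) → PM.≺-≤-trans b≺gB (mono (PL.⋁β-least-≺ B B≺A)))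
                   , (λ b≺gA → let (B , B≺A , b≺gB) = ≺-fun-finite g b≺gA in B , b≺gB , B≺A)
  }
  where
  module M = ContLat M
  module PL = ContLatProperties L
  module PM = ContLatProperties M
  open ScottMap g

points : Functor (op ContFCov) ContLatScott
Functor.F₀ points = Points.lattice
Functor.F₁ points = pull
Functor.F-resp points r≐r′ P =
    (λ b (C , bC , C⊆P) → C , proj₁ (r≐r′ b C) bC , C⊆P)
  , (λ b (C , bC , C⊆P) → C , proj₂ (r≐r′ b C) bC , C⊆P)
Functor.F-id points {X} P = round-least (U P) P (λ _ u → u) , ⊑-round P (U P) (λ _ u → u)
  where open Points X
Functor.F-∘ points {X} {Y} {Z} r s P =
    (λ c (A , (B , cB , BA) , A⊆P) → B , cB , λ b m → A , BA b m , A⊆P)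
  , (λ c (B , cB , B⊆) →
       let (A , BA , A⊆P) = collect (Approximable.rel r) (Points.U {X} P) B B⊆
       in A , (B , cB , λ b m → let (_ , bD , D⊆A) = BA b m in rel-up r D⊆A bD) , A⊆P)

basisCovers : Functor ContLatScott (op ContFCov)
Functor.F₀ basisCovers = basisCover
Functor.F₁ basisCovers = scottToApprox
Functor.F-resp basisCovers {L} {M} g≈g′ b A =
    (λ b≺gA → ≺-≤-trans b≺gA (proj₁ (g≈g′ (⋁β A))))
  , (λ b≺g′A → ≺-≤-trans b≺g′A (proj₂ (g≈g′ (⋁β A))))
  where open ContLatProperties L using (⋁β)
        open ContLatProperties M using (≺-≤-trans)
Functor.F-id basisCovers b A = (λ b≺A → b≺A) , (λ b≺A → b≺A)
Functor.F-∘ basisCovers {L} {M} {N} f g b C =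
    (λ b≺gfC → let (B , B≺fC , b≺gB) = ≺-fun-finite g b≺gfC in B , b≺gB , B≺fC)
  , (λ (B , b≺gB , B≺fC) → PN.≺-≤-trans b≺gB (ScottMap.mono g (PM.⋁β-least-≺ B B≺fC)))
  where module PM = ContLatProperties M
        module PN = ContLatProperties N

module Unit (X : ContFCovObj) where
  open ContFCovObj X
  open Points X
  open ContLatProperties (F₀ points X)
    using (⋁β; ⋁β-upper; ⋁β-least; ⋁β-mono; ⋁β-least-≺; ≺-≤-trans; interpolate-⋁β)

  U⇔U-⋁β : ∀ W a → (Σ (List (List S)) (λ 𝔹 → U (⋁β 𝔹) a × Every (_≺ₚ W) 𝔹) → U W a)
                   × (U W a → Σ (List (List S)) λ 𝔹 → U (⋁β 𝔹) a × Every (_≺ₚ W) 𝔹)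
  U⇔U-⋁β W a =
      (λ (𝔹 , a∈𝔹 , 𝔹≺W) → ⋁β-least 𝔹 {W} (λ B m → ≺ₚ⇒⊑ {B} {W} (𝔹≺W B m)) a a∈𝔹)
    , (λ u → let (C , a≪C , C⊆W) = rounded⇒ W u
             in [ C ] , ⋁β-upper [ C ] (here refl) a (principal-intro a≪C)
                , every-[]⁺ (C , C⊆W , λ _ v → v))

  ≺ₚ⇔≺ₚ-principal : ∀ B W → (Σ (List S) (λ A → B ≺ₚ principal A × Every (U W) A) → B ≺ₚ W)
                        × (B ≺ₚ W → Σ (List S) λ A → B ≺ₚ principal A × Every (U W) A)
  ≺ₚ⇔≺ₚ-principal B W =
      (λ (A , B≺A , A⊆W) → ≺-≤-trans {B} {principal A} {W} B≺A (principal-least W A⊆W))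
    , (λ (C , C⊆W , B⊑C) →
         let (A , ≪A , A⊆W) = collect _≪_ (U W) C (λ c m → rounded⇒ W (C⊆W c m))
             C⊆A c m = let (_ , c≪D , D⊆A) = ≪A c m in principal-intro (≪-up X D⊆A c≪D)
         in A , (C , C⊆A , B⊑C) , A⊆W)

  η : Approximable X (F₀ basisCovers (F₀ points X))
  Approximable.rel η a 𝔸 = U (⋁β 𝔸) a
  Approximable.rel-ext η a 𝔸 𝔹 (𝔸⊆𝔹 , _) = ⋁β-mono 𝔸 𝔹 𝔸⊆𝔹 a
  Approximable.rel-≪ˡ η a 𝔸 = (λ (A , a≪A , A⊆) → rounded⇐ (⋁β 𝔸) A a≪A A⊆) , rounded⇒ (⋁β 𝔸)
  Approximable.rel-≪ʳ η a 𝔸 = U⇔U-⋁β (⋁β 𝔸) a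

  η⁻¹ : Approximable (F₀ basisCovers (F₀ points X)) X
  Approximable.rel η⁻¹ B A = B ≺ₚ principal A
  Approximable.rel-ext η⁻¹ B A A′ (A⊆A′ , _) B≺A =
    ≺-≤-trans {B} {principal A} {principal A′} B≺A (principal-mono A⊆A′)
  Approximable.rel-≪ˡ η⁻¹ B A =
      (λ (𝔹 , B≺𝔹 , 𝔹≺A) →
         ≺-≤-trans {B} {⋁β 𝔹} {principal A} B≺𝔹 (⋁β-least-≺ 𝔹 {principal A} 𝔹≺A))
    , interpolate-⋁β {B} {principal A}
  Approximable.rel-≪ʳ η⁻¹ B A =
      (λ (A′ , B≺A′ , A′≪A) → to (A′ , B≺A′ , λ a m → principal-intro (A′≪A a m)))
    , (λ B≺A → let (A′ , B≺A′ , A′⊆A) = from B≺A in A′ , B≺A′ , λ a m → principal-elim (A′⊆A a m))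
    where open Σ (≺ₚ⇔≺ₚ-principal B (principal A)) renaming (proj₁ to to; proj₂ to from)

module Counit (L : ContLat) where
  open ContLat L
  open ContLatProperties L
  open Points (F₀ basisCovers L)

  ε : ScottMap (F₀ points (F₀ basisCovers L)) L
  ε = record
    { fun = λ 𝒰 → supβ (U 𝒰)
    ; mono = λ 𝒰⊑𝒱 → supβ-mono 𝒰⊑𝒱
    ; pres-⋁ = λ α dir y αi↦y → supβ-least _ (λ A A⊆⋁ →
        let (k , A⊆αk) = every-⋁ₚ-elim α dir A A⊆⋁
        in ≤-trans (supβ-upper (U (α k)) A A⊆αk) (αi↦y k))
    }

  ↡ : Carrier → Point
  ↡ x = record
    { U = _≺ x
    ; rounded⇒ = interpolate-⋁β
    ; rounded⇐ = λ A b≺A A≺x → ≺-≤-trans b≺A (⋁β-least-≺ A A≺x)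
    }

  ε⁻¹ : ScottMap L (F₀ points (F₀ basisCovers L))
  ε⁻¹ = record
    { fun = ↡
    ; mono = λ x≤y b b≺x → ≺-≤-trans b≺x x≤y
    ; pres-⋁ = λ α dir 𝒰 αi⊑𝒰 b b≺⋁ →
        let (d , b≺d , d≺⋁) = interpolate b≺⋁
            (i , d≤αi) = ≺⇒≪ d _ d≺⋁ α dir ≤-refl
        in αi⊑𝒰 i b (≺-≤-trans b≺d d≤αi)
    }

private
  module OC = Cat (op ContFCov)
  module CL = Cat ContLatScott

unit-inverseˡ : ∀ X → (Unit.η X OC.∘ Unit.η⁻¹ X) OC.≈ OC.id
unit-inverseˡ X a A =
    (λ x → principal-elim {a} {A} (proj₁ (U⇔U-⋁β (principal A) a) x))
  , (λ a≪A → proj₂ (U⇔U-⋁β (principal A) a) (principal-intro {a} {A} a≪A))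
  where open Unit X
        open Points X

unit-inverseʳ : ∀ X → (Unit.η⁻¹ X OC.∘ Unit.η X) OC.≈ OC.id
unit-inverseʳ X B 𝔸 = Unit.≺ₚ⇔≺ₚ-principal X B (⋁β 𝔸)
  where open ContLatProperties (F₀ points X) using (⋁β)

unit-natural : ∀ {X Y} (r : OC.Hom X Y) →
               (Unit.η Y OC.∘ F₁ basisCovers (F₁ points r)) OC.≈ (r OC.∘ Unit.η X)
unit-natural {X} {Y} r b 𝔸 = Unit.U⇔U-⋁β Y (ScottMap.fun (pull r) (⋁β 𝔸)) b
  where open ContLatProperties (F₀ points X) using (⋁β)

counit-inverseˡ : ∀ L → (Counit.ε L CL.∘ Counit.ε⁻¹ L) CL.≈ CL.id
counit-inverseˡ L x = supβ-≺-≤ x , ≤-supβ-≺ x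
  where open ContLatProperties L

counit-inverseʳ : ∀ L → (Counit.ε⁻¹ L CL.∘ Counit.ε L) CL.≈ CL.id
counit-inverseʳ L 𝒰 =
    (λ b b≺𝒰 → let (A , A⊆𝒰 , b≺A) = ≺-supβ-finite (U 𝒰) b≺𝒰 in rounded⇐ 𝒰 A b≺A A⊆𝒰)
  , (λ b u → let (A , b≺A , A⊆𝒰) = rounded⇒ 𝒰 u in ≺-≤-trans b≺A (supβ-upper (U 𝒰) A A⊆𝒰))
  where open ContLatProperties L
        open Points (F₀ basisCovers L)

counit-natural : ∀ {L M} (g : CL.Hom L M) →
                 (Counit.ε M CL.∘ F₁ points (F₁ basisCovers g)) CL.≈ (g CL.∘ Counit.ε L)
counit-natural {L} {M} g 𝒰 =
    PM.supβ-least _ (λ A A⊆g𝒰 → PM.⋁β-least A λ b m →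
      let (C , b≺gC , C⊆𝒰) = A⊆g𝒰 b m
      in M.≤-trans (PM.≺⇒≤ b≺gC) (mono (PL.supβ-upper (U 𝒰) C C⊆𝒰)))
  , pres-⋁ _ (PL.finJoin-directed (U 𝒰)) _ (λ (C , C⊆𝒰) →
      M.≤-trans (PM.≤-supβ-≺ (fun (PL.⋁β C))) (PM.supβ-mono (λ b b≺gC → C , b≺gC , C⊆𝒰)))
  where module M = ContLat M
        module PL = ContLatProperties L
        module PM = ContLatProperties M
        open ScottMap g
        open Points (F₀ basisCovers L) using (U)

theorem4p13 : DualEquivalence ContFCov ContLatScott
theorem4p13 = record
  { F = points
  ; G = basisCovers
  ; η = Unit.η
  ; η⁻¹ = Unit.η⁻¹
  ; η-iso₁ = unit-inverseˡ
  ; η-iso₂ = unit-inverseʳ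
  ; η-nat = unit-natural
  ; ε = Counit.ε
  ; ε⁻¹ = Counit.ε⁻¹
  ; ε-iso₁ = counit-inverseˡ
  ; ε-iso₂ = counit-inverseʳ
  ; ε-nat = counit-natural
  }
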